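{- Let $A,B,C,C'\in\mathbb{F}_2^{m\times m}$ with $t(A,B,C)=0$ and $t(A,B,C')=0$, and denote by $\mathbf{a}_k,\mathbf{b}_k,\mathbf{c}_k,\mathbf{c}'_k\in\mathbb{F}_2^{1\times m}$ the $k$-th rows of $A,B,C,C'$ respectively. For nonnegative integers $i,j$ with $i+j\le m-1$ define the subspaces of $\mathbb{F}_2^{1\times m}$ $$V_{i,j}:=\langle \mathbf{a}_1,\dots,\mathbf{a}_i,\mathbf{b}_1,\dots,\mathbf{b}_{m-i-j-1},\mathbf{c}_1,\dots,\mathbf{c}_j\rangle,\qquad W_{i,j}:=\langle \mathbf{a}_1,\dots,\mathbf{a}_i,\mathbf{b}_1,\dots,\mathbf{b}_{m-i-j-1},\mathbf{c}'_1,\dots,\mathbf{c}'_j\rangle.$$ Then: (i) $\mathbf{c}'_j\in\mathbf{c}_j+\langle\mathbf{c}_1,\dots,\mathbf{c}_{j-1}\rangle$ for all $1\le j\le m$; (ii) $\langle\mathbf{c}_1,\dots,\mathbf{c}_j\rangle=\langle\mathbf{c}'_1,\dots,\mathbf{c}'_j\rangle$ for all $1\le j\le m$; (iii) $V_{i,j}=W_{i,j}$ for all nonnegative integers $i,j$ with $i+j\le m-1$.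
   Context: $\mathbb{F}_2=\{0,1\}$ is the field with two elements and $\mathbb{F}_2^{m\times m}$ the set of $m\times m$ matrices over $\mathbb{F}_2$. For $C_1,\dots,C_s\in\mathbb{F}_2^{m\times m}$, the digital net generated by $(C_1,\dots,C_s)$ is the point set $\{\mathbf{x}_0,\dots,\mathbf{x}_{2^m-1}\}\subset[0,1)^s$ defined as follows: for $0\le l<2^m$ write $l=\iota_0+\iota_1 2+\dots+\iota_{m-1}2^{m-1}$ with $\iota_k\in\mathbb{F}_2$, put $\mathbf{y}_{l,j}=C_j(\iota_0,\dots,\iota_{m-1})^\top\in\mathbb{F}_2^m$ and $\mathbf{x}_l=(\phi(\mathbf{y}_{l,1}),\dots,\phi(\mathbf{y}_{l,s}))$, where $\phi((y_1,\dots,y_m)^\top)=\sum_{k=1}^m y_k 2^{ -k}$. For $0\le t\le m$, a point set $\{\mathbf{x}_0,\dots,\mathbf{x}_{2^m-1}\}\subset[0,1)^s$ is a $(t,m,s)$-net over $\mathbb{F}_2$ if for all nonnegative integers $d_1,\dots,d_s$ with $d_1+\dots+d_s=m-t$, every elementary interval $\prod_{i=1}^s[a_i/2^{d_i},(a_i+1)/2^{d_i})$ with integers $0\le a_i<2^{d_i}$ contains exactly $2^t$ of the points (counted with multiplicity). $t(C_1,\dots,C_s)$ denotes the $t$-value of the digital net generated by $(C_1,\dots,C_s)$, i.e. the least $t$ for which it is a $(t,m,s)$-net over $\mathbb{F}_2$. $\langle\cdots\rangle$ denotes the $\mathbb{F}_2$-linear span (the empty span being $\{0\}$). -}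

module Defs where

open import Data.Bool using (Bool; true; false; _xor_; _∧_; if_then_else_)
open import Data.Nat using (ℕ; zero; suc; _+_; _*_; _∸_; _^_; _≤_; _<_; _/_; _%_; _≡ᵇ_; _≤ᵇ_; _<ᵇ_)
open import Data.Fin using (Fin; toℕ)
open import Data.Vec as Vec using (Vec; []; _∷_; lookup; zipWith; replicate; foldr)
open import Data.List as List using (List; upTo; map; length; take)
open import Data.Nat.ListAction using (sum)
open import Data.Empty using (⊥)
open import Data.Product using (Σ; _×_; ∃)
open import Relation.Binary.PropositionalEquality using (_≡_)

-- F₂ is modelled by Bool: addition = xor, multiplication = ∧.

Row : ℕ → Set
Row m = Vec Bool m

-- An m×m matrix over F₂, given as the vector of its m rows (row k = lookup M k, 0-based).
Mat : ℕ → Set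
Mat m = Vec (Row m) m

rowsOf : ∀ {m} → Mat m → List (Row m)
rowsOf M = Vec.toList M

_⊕_ : ∀ {m} → Row m → Row m → Row m
_⊕_ = zipWith _xor_

zeroV : ∀ {m} → Row m
zeroV = replicate _ false

_·_ : ∀ {m} → Bool → Row m → Row m
b · v = Vec.map (λ x → b ∧ x) v

lincomb : ∀ {m} (L : List (Row m)) → Vec Bool (length L) → Row m
lincomb List.[] [] = zeroV
lincomb (v List.∷ L) (c ∷ cs) = (c · v) ⊕ lincomb L cs

InSpan : ∀ {m} → List (Row m) → Row m → Set
InSpan L v = Σ (Vec Bool (length L)) λ cs → lincomb L cs ≡ v

SameSpan : ∀ {m} → List (Row m) → List (Row m) → Set
SameSpan L L' = ∀ v → (InSpan L v → InSpan L' v) × (InSpan L' v → InSpan L v)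

-- binary digits (ι₀,…,ι_{m-1}) of l, least significant first
digits : (m : ℕ) → ℕ → Vec Bool m
digits zero l = []
digits (suc m) l = (l % 2 ≡ᵇ 1) ∷ digits m (l / 2)

dot : ∀ {m} → Row m → Vec Bool m → Bool
dot r v = foldr _ _xor_ false (zipWith _∧_ r v)

matVec : ∀ {m} → Mat m → Vec Bool m → Vec Bool m
matVec C v = Vec.map (λ r → dot r v) C

-- 2^n · φ(y) for y ∈ F₂^n, i.e. φ(y) = scaled y / 2^n (an exact natural number)
scaled : ∀ {n} → Vec Bool n → ℕ
scaled [] = 0
scaled {suc n} (b ∷ ys) = (if b then 2 ^ n else 0) + scaled ys

-- 2^m · (j-th coordinate of the point x_l) of the digital net generated by Cs
coord : ∀ {m s} → Vec (Mat m) s → ℕ → Fin s → ℕ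
coord {m} Cs l j = scaled (matVec (lookup Cs j) (digits m l))

-- x ∈ [a/2^d, (a+1)/2^d) where x = N / 2^m and d ≤ m:
-- equivalently a·2^(m-d) ≤ N < (a+1)·2^(m-d)
inIntervalᵇ : (m d a N : ℕ) → Bool
inIntervalᵇ m d a N = (a * 2 ^ (m ∸ d) ≤ᵇ N) ∧ (N <ᵇ suc a * 2 ^ (m ∸ d))

inBoxᵇ : ∀ {m s} → Vec (Mat m) s → Vec ℕ s → Vec ℕ s → ℕ → Bool
inBoxᵇ {m} {s} Cs d a l = go (Vec.allFin s)
  where
  go : ∀ {k} → Vec (Fin s) k → Bool
  go [] = true
  go (i ∷ is) = inIntervalᵇ m (lookup d i) (lookup a i) (coord Cs l i) ∧ go is

countInBox : ∀ {m s} → Vec (Mat m) s → Vec ℕ s → Vec ℕ s → ℕ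
countInBox {m} Cs d a = sum (map (λ l → if inBoxᵇ Cs d a l then 1 else 0) (upTo (2 ^ m)))

vsum : ∀ {s} → Vec ℕ s → ℕ
vsum = foldr _ _+_ 0

IsNet : ∀ {m s} → ℕ → Vec (Mat m) s → Set
IsNet {m} {s} t Cs =
  t ≤ m ×
  ((d a : Vec ℕ s) → vsum d ≡ m ∸ t →
    (∀ i → lookup a i < 2 ^ lookup d i) →
    countInBox Cs d a ≡ 2 ^ t)

TValue : ∀ {m s} → Vec (Mat m) s → ℕ → Set
TValue Cs t = IsNet t Cs × (∀ t' → t' < t → IsNet t' Cs → ⊥)

{-# OPTIONS --safe #-}
-- If t(A,B,C) = 0 then for every d₁ + d₂ + d₃ = m the first d₁ rows of A, the first d₂ rows
-- of B and the first d₃ rows of C form a basis of F₂^{1×m}; only these bases are used afterwards.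
-- By induction on j, the rows c₁,…,c_j and c′₁,…,c′_j have the same common kernel K: for z ∈ K
-- one shows c_{j+1}·z = c′_{j+1}·z by pushing z into the kernels of a₁, a₂, … one row at a time,
-- correcting it when needed by a vector w with a_i·w = c_{j+1}·w = c′_{j+1}·w = 1, which the
-- bases with d₃ = j + 1 provide; after m − j steps the basis (a₁,…,a_{m−j},c₁,…,c_j) forces
-- z = 0. Since a set of rows contained in a basis spans the annihilator of its kernel, equal
-- kernels give (ii) and (iii), and c_{j+1} + c′_{j+1} vanishing on K gives (i).

module Submission where

open import Defs
open import Algebra.Bundles using (CommutativeRing)
open import Data.Bool using (Bool; true; false; _xor_; _∧_; if_then_else_; T)
open import Data.Bool.Properties
  using ( xor-assoc; xor-identityˡ; xor-identityʳ; xor-same; xor-∧-commutativeRing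
        ; ∧-comm; ∧-assoc; ∧-zeroʳ; ∧-identityʳ; ∧-distribˡ-xor; ¬-not; T-∧ )
open import Data.Fin as Fin using (Fin; toℕ; fromℕ<)
open import Data.Fin.Properties using (fromℕ<-toℕ; toℕ<n)
open import Data.List as List using (List; []; _∷_; take; drop; length; upTo; [_])
open import Data.List using () renaming (_++_ to _++ₗ_)
open import Data.List.Properties
  using (++-assoc; take-map; length-take; length-drop; take++drop≡id; length-++; upTo-∷ʳ; map-++)
open import Data.List.Relation.Unary.All as All using (All; []; _∷_)
import Data.List.Relation.Unary.All.Properties as All
open import Data.Nat
  using (ℕ; zero; suc; _+_; _*_; _∸_; _^_; _≤_; _<_; z≤n; s≤s; _≤ᵇ_; _<ᵇ_; _/_; _%_; _≡ᵇ_; _⊓_)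
open import Data.Nat.Properties
open import Data.Nat.DivMod using (m*n%n≡0; m*n/n≡m; [m+kn]%n≡m%n; +-distrib-/)
open import Data.Nat.ListAction using (sum)
open import Data.Nat.ListAction.Properties using (sum-++)
open import Data.Nat.Tactic.RingSolver using (solve-∀)
open import Data.Product using (Σ; ∃; _×_; _,_; proj₁; proj₂)
open import Data.Sum using (inj₁; inj₂)
open import Data.Unit using (tt)
open import Data.Vec using (Vec; []; _∷_; lookup; toList)
open import Data.Vec.Properties using (map-const; toList-map; length-toList; toList-injective; cast-is-id; ∷-injective)
open import Data.Vec.Relation.Binary.Pointwise.Inductive
  using (Pointwise-≡⇒≡; zipWith-assoc; zipWith-identityˡ; zipWith-identityʳ)
open import Function using (_⇔_; mk⇔; Equivalence)
open import Relation.Binary.PropositionalEquality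
  using (_≡_; _≢_; refl; sym; trans; cong; cong₂; subst; module ≡-Reasoning)
open import Relation.Nullary using (contradiction)
open import Relation.Binary using (tri<; tri≈; tri>)
open import Algebra.Properties.CommutativeSemigroup
  (CommutativeRing.+-commutativeSemigroup xor-∧-commutativeRing) using (interchange)

open Equivalence using (to; from)
open ≡-Reasoning

private
  variable
    m n : ℕ

⊕-assoc : (u v w : Row n) → (u ⊕ v) ⊕ w ≡ u ⊕ (v ⊕ w)
⊕-assoc u v w = Pointwise-≡⇒≡ (zipWith-assoc xor-assoc u v w)

⊕-identityˡ : (u : Row n) → zeroV ⊕ u ≡ u
⊕-identityˡ u = Pointwise-≡⇒≡ (zipWith-identityˡ xor-identityˡ u)

⊕-identityʳ : (u : Row n) → u ⊕ zeroV ≡ u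
⊕-identityʳ u = Pointwise-≡⇒≡ (zipWith-identityʳ xor-identityʳ u)

⊕-self : (u : Row n) → u ⊕ u ≡ zeroV
⊕-self []      = refl
⊕-self (a ∷ u) = cong₂ _∷_ (xor-same a) (⊕-self u)

⊕-cancelˡ : (u v : Row n) → u ⊕ (u ⊕ v) ≡ v
⊕-cancelˡ u v = begin
  u ⊕ (u ⊕ v)  ≡⟨ ⊕-assoc u u v ⟨
  (u ⊕ u) ⊕ v  ≡⟨ cong (_⊕ v) (⊕-self u) ⟩
  zeroV ⊕ v    ≡⟨ ⊕-identityˡ v ⟩
  v            ∎

⊕≡zero⇒≡ : (u v : Row n) → u ⊕ v ≡ zeroV → u ≡ v
⊕≡zero⇒≡ u v u⊕v≡0 = begin
  u            ≡⟨ ⊕-identityʳ u ⟨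
  u ⊕ zeroV    ≡⟨ cong (u ⊕_) u⊕v≡0 ⟨
  u ⊕ (u ⊕ v)  ≡⟨ ⊕-cancelˡ u v ⟩
  v            ∎

dot-zeroʳ : (u : Row n) → dot u zeroV ≡ false
dot-zeroʳ []      = refl
dot-zeroʳ (a ∷ u) rewrite ∧-zeroʳ a = dot-zeroʳ u

dot-comm : (u v : Row n) → dot u v ≡ dot v u
dot-comm []      []      = refl
dot-comm (a ∷ u) (b ∷ v) = cong₂ _xor_ (∧-comm a b) (dot-comm u v)

dot-zeroˡ : (u : Row n) → dot zeroV u ≡ false
dot-zeroˡ u = trans (dot-comm zeroV u) (dot-zeroʳ u)

dot-distribˡ-⊕ : (r u w : Row n) → dot r (u ⊕ w) ≡ dot r u xor dot r w
dot-distribˡ-⊕ []      []      []      = refl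
dot-distribˡ-⊕ (a ∷ r) (b ∷ u) (c ∷ w) = begin
  (a ∧ (b xor c)) xor dot r (u ⊕ w)                ≡⟨ cong₂ _xor_ (∧-distribˡ-xor a b c) (dot-distribˡ-⊕ r u w) ⟩
  ((a ∧ b) xor (a ∧ c)) xor (dot r u xor dot r w)  ≡⟨ interchange (a ∧ b) (a ∧ c) (dot r u) (dot r w) ⟩
  ((a ∧ b) xor dot r u) xor ((a ∧ c) xor dot r w)  ∎

dot-distribʳ-⊕ : (u w r : Row n) → dot (u ⊕ w) r ≡ dot u r xor dot w r
dot-distribʳ-⊕ u w r = begin
  dot (u ⊕ w) r          ≡⟨ dot-comm (u ⊕ w) r ⟩
  dot r (u ⊕ w)          ≡⟨ dot-distribˡ-⊕ r u w ⟩
  dot r u xor dot r w    ≡⟨ cong₂ _xor_ (dot-comm r u) (dot-comm r w) ⟩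
  dot u r xor dot w r    ∎

dot-·ˡ : ∀ c (r z : Row n) → dot (c · r) z ≡ c ∧ dot r z
dot-·ˡ c []      []      = sym (∧-zeroʳ c)
dot-·ˡ c (a ∷ r) (b ∷ z) = begin
  ((c ∧ a) ∧ b) xor dot (c · r) z  ≡⟨ cong₂ _xor_ (∧-assoc c a b) (dot-·ˡ c r z) ⟩
  (c ∧ (a ∧ b)) xor (c ∧ dot r z)  ≡⟨ ∧-distribˡ-xor c (a ∧ b) (dot r z) ⟨
  c ∧ dot (a ∷ r) (b ∷ z)          ∎

dot-shift : (r z w : Row n) → dot r z ≡ dot r (z ⊕ w) xor dot r w
dot-shift r z w = begin
  dot r z                              ≡⟨ xor-identityʳ (dot r z) ⟨
  dot r z xor false                    ≡⟨ cong (dot r z xor_) (xor-same (dot r w)) ⟨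
  dot r z xor (dot r w xor dot r w)    ≡⟨ xor-assoc (dot r z) (dot r w) (dot r w) ⟨
  (dot r z xor dot r w) xor dot r w    ≡⟨ cong (_xor dot r w) (dot-distribˡ-⊕ r z w) ⟨
  dot r (z ⊕ w) xor dot r w            ∎

dot-nondegenerate : (u v : Row n) → (∀ z → dot u z ≡ dot v z) → u ≡ v
dot-nondegenerate []      []      _ = refl
dot-nondegenerate (a ∷ u) (b ∷ v) h =
  cong₂ _∷_ heads (dot-nondegenerate u v (λ z → trans (sym (dot-tail a u z)) (trans (h (false ∷ z)) (dot-tail b v z))))
  where
  dot-head : ∀ a (u : Row n) → dot (a ∷ u) (true ∷ zeroV) ≡ a
  dot-head a u rewrite dot-zeroʳ u = trans (xor-identityʳ (a ∧ true)) (∧-identityʳ a)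
  dot-tail : ∀ a (u z : Row n) → dot (a ∷ u) (false ∷ z) ≡ dot u z
  dot-tail a u z rewrite ∧-zeroʳ a = refl
  heads : a ≡ b
  heads = trans (sym (dot-head a u)) (trans (h (true ∷ zeroV)) (dot-head b v))

additive-zero : (f : Vec Bool n → Bool) → (∀ t t′ → f (t ⊕ t′) ≡ f t xor f t′) → f zeroV ≡ false
additive-zero f additive = begin
  f zeroV                   ≡⟨ cong f (⊕-self zeroV) ⟨
  f (zeroV ⊕ zeroV)         ≡⟨ additive zeroV zeroV ⟩
  f zeroV xor f zeroV       ≡⟨ xor-same (f zeroV) ⟩
  false                     ∎

additive⇒dot : (f : Vec Bool n → Bool) → (∀ t t′ → f (t ⊕ t′) ≡ f t xor f t′) →
               ∃ λ ys → ∀ t → f t ≡ dot ys t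
additive⇒dot {zero}  f additive = [] , λ { [] → additive-zero f additive }
additive⇒dot {suc n} f additive = f (true ∷ zeroV) ∷ ys , represents
  where
  tail-rep = additive⇒dot (λ t → f (false ∷ t)) (λ t t′ → additive (false ∷ t) (false ∷ t′))
  ys = proj₁ tail-rep
  f-head : ∀ b → f (b ∷ zeroV) ≡ f (true ∷ zeroV) ∧ b
  f-head true  = sym (∧-identityʳ _)
  f-head false = trans (additive-zero f additive) (sym (∧-zeroʳ _))
  represents : ∀ t → f t ≡ dot (f (true ∷ zeroV) ∷ ys) t
  represents (b ∷ t) = begin
    f (b ∷ t)                            ≡⟨ cong f (cong₂ _∷_ (xor-identityʳ b) (⊕-identityˡ t)) ⟨
    f ((b ∷ zeroV) ⊕ (false ∷ t))        ≡⟨ additive (b ∷ zeroV) (false ∷ t) ⟩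
    f (b ∷ zeroV) xor f (false ∷ t)      ≡⟨ cong₂ _xor_ (f-head b) (proj₂ tail-rep t) ⟩
    (f (true ∷ zeroV) ∧ b) xor dot ys t  ∎

-- Systems of linear forms

dots : (L : List (Row m)) → Row m → Vec Bool (length L)
dots []      z = []
dots (r ∷ L) z = dot r z ∷ dots L z

Ker : List (Row m) → Row m → Set
Ker L z = All (λ r → dot r z ≡ false) L

dot-lincomb : (L : List (Row m)) (cs : Vec Bool (length L)) (z : Row m) →
              dot (lincomb L cs) z ≡ dot cs (dots L z)
dot-lincomb []      []       z = dot-zeroˡ z
dot-lincomb (r ∷ L) (c ∷ cs) z = begin
  dot ((c · r) ⊕ lincomb L cs) z          ≡⟨ dot-distribʳ-⊕ (c · r) (lincomb L cs) z ⟩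
  dot (c · r) z xor dot (lincomb L cs) z  ≡⟨ cong₂ _xor_ (dot-·ˡ c r z) (dot-lincomb L cs z) ⟩
  (c ∧ dot r z) xor dot cs (dots L z)     ∎

dots-⊕ : (L : List (Row m)) (u w : Row m) → dots L (u ⊕ w) ≡ dots L u ⊕ dots L w
dots-⊕ []      u w = refl
dots-⊕ (r ∷ L) u w = cong₂ _∷_ (dot-distribˡ-⊕ r u w) (dots-⊕ L u w)

lincomb-zero : (L : List (Row m)) → lincomb L zeroV ≡ zeroV
lincomb-zero []      = refl
lincomb-zero (r ∷ L) = trans (cong₂ _⊕_ (map-const r false) (lincomb-zero L)) (⊕-self zeroV)

Ker⇒dots≡zero : (L : List (Row m)) {z : Row m} → Ker L z → dots L z ≡ zeroV
Ker⇒dots≡zero []      []       = refl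
Ker⇒dots≡zero (r ∷ L) (rz ∷ k) = cong₂ _∷_ rz (Ker⇒dots≡zero L k)

dots≡zero⇒Ker : (L : List (Row m)) {z : Row m} → dots L z ≡ zeroV → Ker L z
dots≡zero⇒Ker []      _  = []
dots≡zero⇒Ker (r ∷ L) eq = proj₁ (∷-injective eq) ∷ dots≡zero⇒Ker L (proj₂ (∷-injective eq))

Ker-zero : (L : List (Row m)) → Ker L zeroV
Ker-zero L = All.tabulate (λ {r} _ → dot-zeroʳ r)

Ker-⊕ : {L : List (Row m)} {u w : Row m} → Ker L u → Ker L w → Ker L (u ⊕ w)
Ker-⊕ [] [] = []
Ker-⊕ {L = r ∷ _} {u} {w} (ru ∷ ku) (rw ∷ kw) =
  trans (dot-distribˡ-⊕ r u w) (cong₂ _xor_ ru rw) ∷ Ker-⊕ ku kw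

InSpan⇒⊥Ker : {L : List (Row m)} {v z : Row m} → InSpan L v → Ker L z → dot v z ≡ false
InSpan⇒⊥Ker {L = L} {z = z} (cs , refl) k = begin
  dot (lincomb L cs) z  ≡⟨ dot-lincomb L cs z ⟩
  dot cs (dots L z)     ≡⟨ cong (dot cs) (Ker⇒dots≡zero L k) ⟩
  dot cs zeroV          ≡⟨ dot-zeroʳ cs ⟩
  false                 ∎

record Nonsingular {m} (L : List (Row m)) : Set where
  field
    kernel-trivial : ∀ z → Ker L z → z ≡ zeroV
    dots-onto      : ∀ t → ∃ λ z → dots L z ≡ t

open Nonsingular

dots-injective : {L : List (Row m)} → Nonsingular L → ∀ u w → dots L u ≡ dots L w → u ≡ w
dots-injective {L = L} ns u w eq = ⊕≡zero⇒≡ u w (kernel-trivial ns (u ⊕ w) (dots≡zero⇒Ker L dots-u⊕w))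
  where
  dots-u⊕w : dots L (u ⊕ w) ≡ zeroV
  dots-u⊕w = trans (dots-⊕ L u w) (trans (cong (_⊕ dots L w) eq) (⊕-self (dots L w)))

-- The coefficients of v are those representing the additive functional t ↦ v · dots⁻¹ t.
Nonsingular⇒InSpan : {L : List (Row m)} → Nonsingular L → ∀ v → InSpan L v
Nonsingular⇒InSpan {L = L} ns v = ys , dot-nondegenerate (lincomb L ys) v agrees
  where
  preimage : Vec Bool (length L) → Row _
  preimage t = proj₁ (dots-onto ns t)
  preimage-⊕ : ∀ t t′ → preimage (t ⊕ t′) ≡ preimage t ⊕ preimage t′
  preimage-⊕ t t′ = dots-injective ns _ _ (begin
    dots L (preimage (t ⊕ t′))                ≡⟨ proj₂ (dots-onto ns (t ⊕ t′)) ⟩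
    t ⊕ t′                                    ≡⟨ cong₂ _⊕_ (proj₂ (dots-onto ns t)) (proj₂ (dots-onto ns t′)) ⟨
    dots L (preimage t) ⊕ dots L (preimage t′) ≡⟨ dots-⊕ L (preimage t) (preimage t′) ⟨
    dots L (preimage t ⊕ preimage t′)          ∎)
  rep = additive⇒dot (λ t → dot v (preimage t))
          (λ t t′ → trans (cong (dot v) (preimage-⊕ t t′)) (dot-distribˡ-⊕ v (preimage t) (preimage t′)))
  ys = proj₁ rep
  agrees : ∀ z → dot (lincomb L ys) z ≡ dot v z
  agrees z = begin
    dot (lincomb L ys) z          ≡⟨ dot-lincomb L ys z ⟩
    dot ys (dots L z)             ≡⟨ proj₂ rep (dots L z) ⟨
    dot v (preimage (dots L z))   ≡⟨ cong (dot v) (dots-injective ns _ _ (proj₂ (dots-onto ns (dots L z)))) ⟩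
    dot v z                       ∎

joinᵛ : {X : Set} (L₁ L₂ : List X) → Vec Bool (length L₁) → Vec Bool (length L₂) → Vec Bool (length (L₁ ++ₗ L₂))
joinᵛ []       L₂ []       t₂ = t₂
joinᵛ (_ ∷ L₁) L₂ (b ∷ t₁) t₂ = b ∷ joinᵛ L₁ L₂ t₁ t₂

splitᵛ : {X : Set} (L₁ L₂ : List X) → Vec Bool (length (L₁ ++ₗ L₂)) → Vec Bool (length L₁) × Vec Bool (length L₂)
splitᵛ []       L₂ t       = [] , t
splitᵛ (_ ∷ L₁) L₂ (b ∷ t) = b ∷ proj₁ (splitᵛ L₁ L₂ t) , proj₂ (splitᵛ L₁ L₂ t)

joinᵛ-splitᵛ : {X : Set} (L₁ L₂ : List X) (t : Vec Bool (length (L₁ ++ₗ L₂))) →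
               joinᵛ L₁ L₂ (proj₁ (splitᵛ L₁ L₂ t)) (proj₂ (splitᵛ L₁ L₂ t)) ≡ t
joinᵛ-splitᵛ []       L₂ t       = refl
joinᵛ-splitᵛ (_ ∷ L₁) L₂ (b ∷ t) = cong (b ∷_) (joinᵛ-splitᵛ L₁ L₂ t)

joinᵛ-injective : {X : Set} (L₁ L₂ : List X) {t₁ t₁′ : Vec Bool (length L₁)} {t₂ t₂′ : Vec Bool (length L₂)} →
                  joinᵛ L₁ L₂ t₁ t₂ ≡ joinᵛ L₁ L₂ t₁′ t₂′ → t₁ ≡ t₁′ × t₂ ≡ t₂′
joinᵛ-injective []       L₂ {[]}     {[]}     eq = refl , eq
joinᵛ-injective (_ ∷ L₁) L₂ {_ ∷ _} {_ ∷ _} eq =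
  let b≡b′ , rest = ∷-injective eq
      t₁≡t₁′ , t₂≡t₂′ = joinᵛ-injective L₁ L₂ rest
  in cong₂ _∷_ b≡b′ t₁≡t₁′ , t₂≡t₂′

dots-++ : (L₁ L₂ : List (Row m)) (z : Row m) → dots (L₁ ++ₗ L₂) z ≡ joinᵛ L₁ L₂ (dots L₁ z) (dots L₂ z)
dots-++ []       L₂ z = refl
dots-++ (r ∷ L₁) L₂ z = cong (dot r z ∷_) (dots-++ L₁ L₂ z)

lincomb-++ : (L₁ L₂ : List (Row m)) (c₁ : Vec Bool (length L₁)) (c₂ : Vec Bool (length L₂)) →
             lincomb (L₁ ++ₗ L₂) (joinᵛ L₁ L₂ c₁ c₂) ≡ lincomb L₁ c₁ ⊕ lincomb L₂ c₂
lincomb-++ []       L₂ []       c₂ = sym (⊕-identityˡ _)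
lincomb-++ (r ∷ L₁) L₂ (c ∷ c₁) c₂ =
  trans (cong ((c · r) ⊕_) (lincomb-++ L₁ L₂ c₁ c₂)) (sym (⊕-assoc (c · r) _ _))

solve-++ : {L₁ L₂ : List (Row m)} → Nonsingular (L₁ ++ₗ L₂) →
           ∀ t₁ t₂ → ∃ λ z → dots L₁ z ≡ t₁ × dots L₂ z ≡ t₂
solve-++ {L₁ = L₁} {L₂} ns t₁ t₂ =
  let z , eq = dots-onto ns (joinᵛ L₁ L₂ t₁ t₂)
  in z , joinᵛ-injective L₁ L₂ (trans (sym (dots-++ L₁ L₂ z)) eq)

Nonsingular-++-comm : {L₁ L₂ : List (Row m)} → Nonsingular (L₁ ++ₗ L₂) → Nonsingular (L₂ ++ₗ L₁)
Nonsingular-++-comm {L₁ = L₁} {L₂} ns = record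
  { kernel-trivial = λ z k → let k₂ , k₁ = All.++⁻ L₂ k in kernel-trivial ns z (All.++⁺ k₁ k₂)
  ; dots-onto      = onto
  }
  where
  onto : ∀ t → ∃ λ z → dots (L₂ ++ₗ L₁) z ≡ t
  onto t = z , (begin
    dots (L₂ ++ₗ L₁) z                    ≡⟨ dots-++ L₂ L₁ z ⟩
    joinᵛ L₂ L₁ (dots L₂ z) (dots L₁ z)   ≡⟨ cong₂ (joinᵛ L₂ L₁) L₂z L₁z ⟩
    joinᵛ L₂ L₁ t₂ t₁                     ≡⟨ joinᵛ-splitᵛ L₂ L₁ t ⟩
    t                                     ∎)
    where
    t₂ = proj₁ (splitᵛ L₂ L₁ t)
    t₁ = proj₂ (splitᵛ L₂ L₁ t)
    sol = solve-++ ns t₁ t₂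
    z   = proj₁ sol
    L₁z = proj₁ (proj₂ sol)
    L₂z = proj₂ (proj₂ sol)

Ker-∷ʳ-witness : {L : List (Row m)} {c : Row m} → Nonsingular (L ++ₗ [ c ]) → ∃ λ z → Ker L z × dot c z ≡ true
Ker-∷ʳ-witness {L = L} ns =
  let z , Lz , cz = solve-++ ns zeroV (true ∷ [])
  in z , dots≡zero⇒Ker L Lz , proj₁ (∷-injective cz)

-- Write w = ∑ q + ∑ p over Q ++ P; the Q-coefficients vanish because, Q ++ P being
-- nonsingular, they can be tested against vectors in the kernel of P.
⊥Ker⇒InSpan : {Q P : List (Row m)} → Nonsingular (Q ++ₗ P) →
               ∀ {w} → (∀ z → Ker P z → dot w z ≡ false) → InSpan P w
⊥Ker⇒InSpan {Q = Q} {P} ns {w} w⊥ = cp , sym w≡P-part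
  where
  cs = proj₁ (Nonsingular⇒InSpan ns w)
  cq = proj₁ (splitᵛ Q P cs)
  cp = proj₂ (splitᵛ Q P cs)
  w≡ : w ≡ lincomb Q cq ⊕ lincomb P cp
  w≡ = begin
    w                                    ≡⟨ proj₂ (Nonsingular⇒InSpan ns w) ⟨
    lincomb (Q ++ₗ P) cs                 ≡⟨ cong (lincomb (Q ++ₗ P)) (joinᵛ-splitᵛ Q P cs) ⟨
    lincomb (Q ++ₗ P) (joinᵛ Q P cq cp)  ≡⟨ lincomb-++ Q P cq cp ⟩
    lincomb Q cq ⊕ lincomb P cp          ∎
  cq≡0 : cq ≡ zeroV
  cq≡0 = dot-nondegenerate cq zeroV λ t →
    let z , Qz≡t , Pz≡0 = solve-++ ns t zeroV
        P-part⊥z : dot (lincomb P cp) z ≡ false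
        P-part⊥z = trans (dot-lincomb P cp z) (trans (cong (dot cp) Pz≡0) (dot-zeroʳ cp))
    in begin
      dot cq t                                         ≡⟨ cong (dot cq) Qz≡t ⟨
      dot cq (dots Q z)                                ≡⟨ dot-lincomb Q cq z ⟨
      dot (lincomb Q cq) z                             ≡⟨ xor-identityʳ _ ⟨
      dot (lincomb Q cq) z xor false                   ≡⟨ cong (dot (lincomb Q cq) z xor_) P-part⊥z ⟨
      dot (lincomb Q cq) z xor dot (lincomb P cp) z    ≡⟨ dot-distribʳ-⊕ (lincomb Q cq) (lincomb P cp) z ⟨
      dot (lincomb Q cq ⊕ lincomb P cp) z              ≡⟨ cong (λ x → dot x z) w≡ ⟨
      dot w z                                          ≡⟨ w⊥ z (dots≡zero⇒Ker P Pz≡0) ⟩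
      false                                            ≡⟨ dot-zeroˡ t ⟨
      dot zeroV t                                      ∎
  w≡P-part : w ≡ lincomb P cp
  w≡P-part = begin
    w                               ≡⟨ w≡ ⟩
    lincomb Q cq ⊕ lincomb P cp     ≡⟨ cong (λ x → lincomb Q x ⊕ lincomb P cp) cq≡0 ⟩
    lincomb Q zeroV ⊕ lincomb P cp  ≡⟨ cong (_⊕ lincomb P cp) (lincomb-zero Q) ⟩
    zeroV ⊕ lincomb P cp            ≡⟨ ⊕-identityˡ _ ⟩
    lincomb P cp                    ∎

sameKer⇒SameSpan : {Q P Q′ P′ : List (Row m)} → Nonsingular (Q ++ₗ P) → Nonsingular (Q′ ++ₗ P′) →
                   (∀ z → Ker P z ⇔ Ker P′ z) → SameSpan P P′
sameKer⇒SameSpan ns ns′ sameKer v =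
    (λ v∈P  → ⊥Ker⇒InSpan ns′ (λ z k → InSpan⇒⊥Ker v∈P  (from (sameKer z) k)))
  , (λ v∈P′ → ⊥Ker⇒InSpan ns  (λ z k → InSpan⇒⊥Ker v∈P′ (to (sameKer z) k)))

-- Binary expansions

bitsToℕ : List Bool → ℕ
bitsToℕ []       = 0
bitsToℕ (b ∷ bs) = (if b then 2 ^ length bs else 0) + bitsToℕ bs

scaled≡bitsToℕ : (y : Vec Bool n) → scaled y ≡ bitsToℕ (toList y)
scaled≡bitsToℕ []              = refl
scaled≡bitsToℕ {suc n} (b ∷ y) =
  cong₂ _+_ (cong (λ k → if b then 2 ^ k else 0) (sym (length-toList y))) (scaled≡bitsToℕ y)

bitsToℕ< : (bs : List Bool) → bitsToℕ bs < 2 ^ length bs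
bitsToℕ< []       = s≤s z≤n
bitsToℕ< (b ∷ bs) =
  <-≤-trans (+-monoʳ-< (lead b) (bitsToℕ< bs))
            (≤-trans (+-monoˡ-≤ (2 ^ k) (lead≤ b)) (≤-reflexive (cong (2 ^ k +_) (sym (+-identityʳ (2 ^ k))))))
  where
  k = length bs
  lead : Bool → ℕ
  lead b = if b then 2 ^ k else 0
  lead≤ : ∀ b → lead b ≤ 2 ^ k
  lead≤ true  = ≤-refl
  lead≤ false = z≤n

bitsToℕ-++ : (p s : List Bool) → bitsToℕ (p ++ₗ s) ≡ bitsToℕ p * 2 ^ length s + bitsToℕ s
bitsToℕ-++ []      s = refl
bitsToℕ-++ (b ∷ p) s = begin
  lead (length (p ++ₗ s)) + bitsToℕ (p ++ₗ s)
    ≡⟨ cong₂ _+_ (cong lead (length-++ p)) (bitsToℕ-++ p s) ⟩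
  lead (length p + length s) + (bitsToℕ p * 2 ^ length s + bitsToℕ s)
    ≡⟨ +-assoc (lead (length p + length s)) _ _ ⟨
  lead (length p + length s) + bitsToℕ p * 2 ^ length s + bitsToℕ s
    ≡⟨ cong (_+ bitsToℕ s) (shift b) ⟩
  (lead (length p) + bitsToℕ p) * 2 ^ length s + bitsToℕ s ∎
  where
  lead : ℕ → ℕ
  lead k = if b then 2 ^ k else 0
  shift : ∀ b → (if b then 2 ^ (length p + length s) else 0) + bitsToℕ p * 2 ^ length s
                ≡ ((if b then 2 ^ length p else 0) + bitsToℕ p) * 2 ^ length s
  shift true  = trans (cong (_+ bitsToℕ p * 2 ^ length s) (^-distribˡ-+-* 2 (length p) (length s)))
                      (sym (*-distribʳ-+ (2 ^ length s) (2 ^ length p) (bitsToℕ p)))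
  shift false = refl

bitsToℕ-injective : (bs cs : List Bool) → length bs ≡ length cs → bitsToℕ bs ≡ bitsToℕ cs → bs ≡ cs
bitsToℕ-injective []       []       _   _   = refl
bitsToℕ-injective (b ∷ bs) (c ∷ cs) len val =
  cong₂ _∷_ (proj₁ heads) (bitsToℕ-injective bs cs len′ (proj₂ heads))
  where
  len′ = suc-injective len
  k = length bs
  split : ∀ b c {x y} → x < 2 ^ k → y < 2 ^ k →
          (if b then 2 ^ k else 0) + x ≡ (if c then 2 ^ k else 0) + y → b ≡ c × x ≡ y
  split true  true  _  _  eq = refl , +-cancelˡ-≡ (2 ^ k) _ _ eq
  split false false _  _  eq = refl , eq
  split true  false _  y< eq = contradiction (subst (_< 2 ^ k) (sym eq) y<) (m+n≮m (2 ^ k) _)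
  split false true  x< _  eq = contradiction (subst (_< 2 ^ k) eq x<) (m+n≮m (2 ^ k) _)
  heads = split b c (bitsToℕ< bs) (subst (λ l → bitsToℕ cs < 2 ^ l) (sym len′) (bitsToℕ< cs))
                (trans val (cong (λ l → (if c then 2 ^ l else 0) + bitsToℕ cs) (sym len′)))

interval-index : ∀ K a v s → s < K →
                 T ((a * K ≤ᵇ v * K + s) ∧ (v * K + s <ᵇ suc a * K)) ⇔ a ≡ v
interval-index K a v s s<K = mk⇔ index-unique index-inside
  where
  N<next : v * K + s < suc v * K
  N<next = subst (v * K + s <_) (+-comm (v * K) K) (+-monoʳ-< (v * K) s<K)
  index-inside : a ≡ v → T ((a * K ≤ᵇ v * K + s) ∧ (v * K + s <ᵇ suc a * K))
  index-inside refl = from T-∧ (≤⇒≤ᵇ (m≤m+n (v * K) s) , <⇒<ᵇ N<next)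
  index-unique : T ((a * K ≤ᵇ v * K + s) ∧ (v * K + s <ᵇ suc a * K)) → a ≡ v
  index-unique inside =
    let lo , hi = to T-∧ inside
    in ≤-antisym (m<1+n⇒m≤n (*-cancelʳ-< K a (suc v) (≤-<-trans (≤ᵇ⇒≤ (a * K) _ lo) N<next)))
                 (m<1+n⇒m≤n (*-cancelʳ-< K v (suc a) (≤-<-trans (m≤m+n (v * K) s) (<ᵇ⇒< _ (suc a * K) hi))))

inInterval⇔ : (y : Vec Bool m) (d a : ℕ) → T (inIntervalᵇ m d a (scaled y)) ⇔ a ≡ bitsToℕ (take d (toList y))
inInterval⇔ {m} y d a =
  subst (λ N → T (inIntervalᵇ m d a N) ⇔ a ≡ bitsToℕ (take d ys)) (sym decomposition)
        (interval-index (2 ^ (m ∸ d)) a _ _ rest<)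
  where
  ys = toList y
  drop-length : length (drop d ys) ≡ m ∸ d
  drop-length = trans (length-drop d ys) (cong (_∸ d) (length-toList y))
  rest< : bitsToℕ (drop d ys) < 2 ^ (m ∸ d)
  rest< = subst (λ l → bitsToℕ (drop d ys) < 2 ^ l) drop-length (bitsToℕ< (drop d ys))
  decomposition : scaled y ≡ bitsToℕ (take d ys) * 2 ^ (m ∸ d) + bitsToℕ (drop d ys)
  decomposition = begin
    scaled y
      ≡⟨ scaled≡bitsToℕ y ⟩
    bitsToℕ ys
      ≡⟨ cong bitsToℕ (take++drop≡id d ys) ⟨
    bitsToℕ (take d ys ++ₗ drop d ys)
      ≡⟨ bitsToℕ-++ (take d ys) (drop d ys) ⟩
    bitsToℕ (take d ys) * 2 ^ length (drop d ys) + bitsToℕ (drop d ys)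
      ≡⟨ cong (λ l → bitsToℕ (take d ys) * 2 ^ l + bitsToℕ (drop d ys)) drop-length ⟩
    bitsToℕ (take d ys) * 2 ^ (m ∸ d) + bitsToℕ (drop d ys) ∎

toList-dots : (L : List (Row m)) (x : Row m) → toList (dots L x) ≡ List.map (λ r → dot r x) L
toList-dots []      x = refl
toList-dots (r ∷ L) x = cong (dot r x ∷_) (toList-dots L x)

take-matVec : (M : Mat m) (d : ℕ) (x : Row m) → take d (toList (matVec M x)) ≡ toList (dots (take d (rowsOf M)) x)
take-matVec M d x = begin
  take d (toList (matVec M x))                   ≡⟨ cong (take d) (toList-map (λ r → dot r x) M) ⟩
  take d (List.map (λ r → dot r x) (toList M))   ≡⟨ take-map d (toList M) ⟩
  List.map (λ r → dot r x) (take d (toList M))   ≡⟨ toList-dots (take d (rowsOf M)) x ⟨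
  toList (dots (take d (rowsOf M)) x)            ∎

fromDigits : Vec Bool n → ℕ
fromDigits []      = 0
fromDigits (b ∷ x) = (if b then 1 else 0) + fromDigits x * 2

digits-fromDigits : (x : Vec Bool n) → digits n (fromDigits x) ≡ x
digits-fromDigits []      = refl
digits-fromDigits (b ∷ x) = cong₂ _∷_ (low-digit b) (trans (cong (digits _) (high-part b)) (digits-fromDigits x))
  where
  k = fromDigits x
  low-digit : ∀ b → (((if b then 1 else 0) + k * 2) % 2 ≡ᵇ 1) ≡ b
  low-digit false = cong (_≡ᵇ 1) (m*n%n≡0 k 2)
  low-digit true  = cong (_≡ᵇ 1) ([m+kn]%n≡m%n 1 k 2)
  high-part : ∀ b → ((if b then 1 else 0) + k * 2) / 2 ≡ k
  high-part false = m*n/n≡m k 2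
  high-part true  = trans (+-distrib-/ 1 (k * 2) (subst (λ r → 1 + r < 2) (sym (m*n%n≡0 k 2)) ≤-refl))
                          (m*n/n≡m k 2)

fromDigits< : (x : Vec Bool n) → fromDigits x < 2 ^ n
fromDigits< []              = s≤s z≤n
fromDigits< {suc n} (b ∷ x) =
  ≤-trans (s≤s (+-monoˡ-≤ (fromDigits x * 2) (low≤1 b)))
          (subst (suc (fromDigits x) * 2 ≤_) (*-comm (2 ^ n) 2) (*-monoˡ-≤ 2 (fromDigits< x)))
  where
  low≤1 : ∀ b → (if b then 1 else 0) ≤ 1
  low≤1 true  = ≤-refl
  low≤1 false = z≤n

digits-zero : ∀ n → digits n 0 ≡ zeroV
digits-zero zero    = refl
digits-zero (suc n) = cong (false ∷_) (digits-zero n)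

count : (ℕ → Bool) → ℕ → ℕ
count f N = sum (List.map (λ l → if f l then 1 else 0) (upTo N))

count-suc : ∀ f N → count f (suc N) ≡ count f N + (if f N then 1 else 0)
count-suc f N = begin
  count f (suc N)                                                     ≡⟨ cong (λ ls → sum (List.map ind ls)) (upTo-∷ʳ N) ⟨
  sum (List.map ind (upTo N ++ₗ [ N ]))                               ≡⟨ cong sum (map-++ ind (upTo N) [ N ]) ⟩
  sum (List.map ind (upTo N) ++ₗ [ ind N ])                           ≡⟨ sum-++ (List.map ind (upTo N)) [ ind N ] ⟩
  count f N + (ind N + 0)                                             ≡⟨ cong (count f N +_) (+-identityʳ (ind N)) ⟩
  count f N + ind N                                                   ∎
  where
  ind : ℕ → ℕ
  ind l = if f l then 1 else 0

count-hit : ∀ f {l} → T (f l) → count f (suc l) ≡ suc (count f l)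
count-hit f {l} hit with f l | count-suc f l
... | true | eq = trans eq (+-comm (count f l) 1)

count-mono : ∀ f {M N} → M ≤ N → count f M ≤ count f N
count-mono f {N = zero}  z≤n   = ≤-refl
count-mono f {M} {suc N} M≤1+N with m≤n⇒m<n∨m≡n M≤1+N
... | inj₁ M<1+N = ≤-trans (count-mono f (m<1+n⇒m≤n M<1+N))
                           (subst (count f N ≤_) (sym (count-suc f N)) (m≤m+n (count f N) _))
... | inj₂ refl  = ≤-refl

count>0⇒∃ : ∀ f N → 0 < count f N → ∃ λ l → l < N × T (f l)
count>0⇒∃ f (suc N) pos with f N in fN
... | true  = N , ≤-refl , subst T (sym fN) tt
... | false =
  let l , l<N , hit = count>0⇒∃ f N (subst (0 <_) count-same pos)
  in l , m<n⇒m<1+n l<N , hit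
  where
  count-same : count f (suc N) ≡ count f N
  count-same = trans (count-suc f N) (trans (cong (λ b → count f N + (if b then 1 else 0)) fN) (+-identityʳ _))

count≥2 : ∀ f {N l l′} → l < l′ → l′ < N → T (f l) → T (f l′) → 2 ≤ count f N
count≥2 f {N} {l} {l′} l<l′ l′<N hit hit′ =
  ≤-trans (s≤s (≤-trans (s≤s z≤n) (≤-reflexive (sym (count-hit f hit)))))
  (≤-trans (s≤s (count-mono f l<l′))
  (≤-trans (≤-reflexive (sym (count-hit f hit′))) (count-mono f l′<N)))

count≡1⇒unique : ∀ f {N} → count f N ≡ 1 → ∀ {l l′} → l < N → l′ < N → T (f l) → T (f l′) → l ≡ l′
count≡1⇒unique f once {l} {l′} l<N l′<N hit hit′ with <-cmp l l′
... | tri< l<l′ _ _ = contradiction (subst (2 ≤_) once (count≥2 f l<l′ l′<N hit hit′)) λ { (s≤s ()) }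
... | tri≈ _ l≡l′ _ = l≡l′
... | tri> _ _ l′<l = contradiction (subst (2 ≤_) once (count≥2 f l′<l l<N hit′ hit)) λ { (s≤s ()) }

-- Digital (0,m,3)-nets

firstRows : Mat m → Mat m → Mat m → ℕ → ℕ → ℕ → List (Row m)
firstRows A B C d₁ d₂ d₃ = take d₁ (rowsOf A) ++ₗ take d₂ (rowsOf B) ++ₗ take d₃ (rowsOf C)

record FirstRowsNonsingular {m} (A B C : Mat m) : Set where
  field
    nonsingular : ∀ d₁ d₂ d₃ → d₁ + d₂ + d₃ ≡ m → Nonsingular (firstRows A B C d₁ d₂ d₃)

open FirstRowsNonsingular

Ker-firstRows : {A B C : Mat m} {d₁ d₂ d₃ : ℕ} {z : Row m} →
                Ker (take d₁ (rowsOf A)) z → Ker (take d₂ (rowsOf B)) z → Ker (take d₃ (rowsOf C)) z →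
                Ker (firstRows A B C d₁ d₂ d₃) z
Ker-firstRows kA kB kC = All.++⁺ kA (All.++⁺ kB kC)

Ker-firstRows⁻ : {A B C : Mat m} (d₁ d₂ : ℕ) {d₃ : ℕ} {z : Row m} → Ker (firstRows A B C d₁ d₂ d₃) z →
                 Ker (take d₁ (rowsOf A)) z × Ker (take d₂ (rowsOf B)) z × Ker (take d₃ (rowsOf C)) z
Ker-firstRows⁻ {A = A} {B} d₁ d₂ k =
  let kA , kBC = All.++⁻ (take d₁ (rowsOf A)) k
      kB , kC  = All.++⁻ (take d₂ (rowsOf B)) kBC
  in kA , kB , kC

bitsToℕ-zero : ∀ n → bitsToℕ (toList (zeroV {n})) ≡ 0
bitsToℕ-zero zero    = refl
bitsToℕ-zero (suc n) = bitsToℕ-zero n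

length-take-rows : (M : Mat m) {d : ℕ} → d ≤ m → length (take d (rowsOf M)) ≡ d
length-take-rows M {d} d≤m =
  trans (length-take d (toList M)) (trans (cong (d ⊓_) (length-toList M)) (m≤n⇒m⊓n≡m d≤m))

-- The elementary box of x_l with side lengths 2^-d₁, 2^-d₂, 2^-d₃ is indexed by the digits
-- dots (firstRows A B C d₁ d₂ d₃) (digits m l); every such box holding exactly one point makes
-- z ↦ dots (firstRows A B C d₁ d₂ d₃) z a bijection.
module _ {m} {A B C : Mat m} (net : IsNet 0 (A ∷ B ∷ C ∷ [])) {d₁ d₂ d₃ : ℕ} (d-sum : d₁ + d₂ + d₃ ≡ m) where

  private
    L₁ = take d₁ (rowsOf A)
    L₂ = take d₂ (rowsOf B)
    L₃ = take d₃ (rowsOf C)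
    L  = firstRows A B C d₁ d₂ d₃

    index : List (Row m) → Row m → ℕ
    index L x = bitsToℕ (toList (dots L x))

    Box : ℕ → ℕ → ℕ → ℕ → Bool
    Box a₁ a₂ a₃ = inBoxᵇ (A ∷ B ∷ C ∷ []) (d₁ ∷ d₂ ∷ d₃ ∷ []) (a₁ ∷ a₂ ∷ a₃ ∷ [])

    interval⇔ : (M : Mat m) (d a : ℕ) (x : Row m) →
                T (inIntervalᵇ m d a (scaled (matVec M x))) ⇔ a ≡ index (take d (rowsOf M)) x
    interval⇔ M d a x = subst (λ bs → T (inIntervalᵇ m d a (scaled (matVec M x))) ⇔ a ≡ bitsToℕ bs)
                              (take-matVec M d x) (inInterval⇔ (matVec M x) d a)

    interval : Mat m → ℕ → ℕ → ℕ → Bool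
    interval M d a l = inIntervalᵇ m d a (scaled (matVec M (digits m l)))

    inBox⁺ : ∀ {a₁ a₂ a₃} l → let x = digits m l in
             a₁ ≡ index L₁ x → a₂ ≡ index L₂ x → a₃ ≡ index L₃ x → T (Box a₁ a₂ a₃ l)
    inBox⁺ {a₁} {a₂} {a₃} l e₁ e₂ e₃ =
      from (T-∧ {interval A d₁ a₁ l}) (from (interval⇔ A d₁ _ x) e₁ ,
      from (T-∧ {interval B d₂ a₂ l}) (from (interval⇔ B d₂ _ x) e₂ ,
      from (T-∧ {interval C d₃ a₃ l}) (from (interval⇔ C d₃ _ x) e₃ , tt)))
      where x = digits m l

    inBox⁻ : ∀ {a₁ a₂ a₃} l → let x = digits m l in
             T (Box a₁ a₂ a₃ l) → a₁ ≡ index L₁ x × a₂ ≡ index L₂ x × a₃ ≡ index L₃ x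
    inBox⁻ {a₁} {a₂} {a₃} l hit =
      let h₁ , hit₂₃ = to (T-∧ {interval A d₁ a₁ l}) hit
          h₂ , hit₃  = to (T-∧ {interval B d₂ a₂ l}) hit₂₃
          h₃ , _     = to (T-∧ {interval C d₃ a₃ l}) hit₃
      in to (interval⇔ A d₁ _ x) h₁ , to (interval⇔ B d₂ _ x) h₂ , to (interval⇔ C d₃ _ x) h₃
      where x = digits m l

    box-count : ∀ {a₁ a₂ a₃} → a₁ < 2 ^ d₁ → a₂ < 2 ^ d₂ → a₃ < 2 ^ d₃ → count (Box a₁ a₂ a₃) (2 ^ m) ≡ 1
    box-count {a₁} {a₂} {a₃} a₁< a₂< a₃< = proj₂ net (d₁ ∷ d₂ ∷ d₃ ∷ []) (a₁ ∷ a₂ ∷ a₃ ∷ []) volume λ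
      { Fin.zero → a₁< ; (Fin.suc Fin.zero) → a₂< ; (Fin.suc (Fin.suc Fin.zero)) → a₃< }
      where
      volume : d₁ + (d₂ + (d₃ + 0)) ≡ m
      volume = trans (cong (λ k → d₁ + (d₂ + k)) (+-identityʳ d₃)) (trans (sym (+-assoc d₁ d₂ d₃)) d-sum)

    index-Ker : (L : List (Row m)) {x : Row m} → Ker L x → index L x ≡ 0
    index-Ker L {x} k = trans (cong (λ v → bitsToℕ (toList v)) (Ker⇒dots≡zero L k)) (bitsToℕ-zero (length L))

    index-injective : (L : List (Row m)) (x : Row m) (t : Vec Bool (length L)) →
                      bitsToℕ (toList t) ≡ index L x → t ≡ dots L x
    index-injective L x t eq = trans (sym (cast-is-id refl t)) (toList-injective refl t (dots L x)
      (bitsToℕ-injective (toList t) (toList (dots L x))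
                         (trans (length-toList t) (sym (length-toList (dots L x)))) eq))

    origin-box : ∀ l → Ker L (digits m l) → T (Box 0 0 0 l)
    origin-box l k = let k₁ , k₂ , k₃ = Ker-firstRows⁻ d₁ d₂ k
                     in inBox⁺ l (sym (index-Ker L₁ k₁)) (sym (index-Ker L₂ k₂)) (sym (index-Ker L₃ k₃))

    d₁≤m : d₁ ≤ m
    d₁≤m = subst (d₁ ≤_) d-sum (≤-trans (m≤m+n d₁ d₂) (m≤m+n (d₁ + d₂) d₃))
    d₂≤m : d₂ ≤ m
    d₂≤m = subst (d₂ ≤_) d-sum (≤-trans (m≤n+m d₂ d₁) (m≤m+n (d₁ + d₂) d₃))
    d₃≤m : d₃ ≤ m
    d₃≤m = subst (d₃ ≤_) d-sum (m≤n+m d₃ (d₁ + d₂))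

    trivial-kernel : ∀ z → Ker L z → z ≡ zeroV
    trivial-kernel z k = begin
      z                        ≡⟨ digits-fromDigits z ⟨
      digits m (fromDigits z)  ≡⟨ cong (digits m) (sym same-point) ⟩
      digits m 0               ≡⟨ digits-zero m ⟩
      zeroV                    ∎
      where
      same-point : 0 ≡ fromDigits z
      same-point = count≡1⇒unique (Box 0 0 0) (box-count (m^n>0 2 d₁) (m^n>0 2 d₂) (m^n>0 2 d₃))
        (m^n>0 2 m) (fromDigits< z)
        (origin-box 0 (subst (Ker L) (sym (digits-zero m)) (Ker-zero L)))
        (origin-box (fromDigits z) (subst (Ker L) (sym (digits-fromDigits z)) k))

    onto : ∀ t → ∃ λ z → dots L z ≡ t
    onto t = x , (begin
      dots L x
        ≡⟨ dots-++ L₁ (L₂ ++ₗ L₃) x ⟩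
      joinᵛ L₁ (L₂ ++ₗ L₃) (dots L₁ x) (dots (L₂ ++ₗ L₃) x)
        ≡⟨ cong (joinᵛ L₁ (L₂ ++ₗ L₃) (dots L₁ x)) (dots-++ L₂ L₃ x) ⟩
      joinᵛ L₁ (L₂ ++ₗ L₃) (dots L₁ x) (joinᵛ L₂ L₃ (dots L₂ x) (dots L₃ x))
        ≡⟨ cong₂ (joinᵛ L₁ (L₂ ++ₗ L₃)) (sym t₁≡) (cong₂ (joinᵛ L₂ L₃) (sym t₂≡) (sym t₃≡)) ⟩
      joinᵛ L₁ (L₂ ++ₗ L₃) t₁ (joinᵛ L₂ L₃ t₂ t₃)
        ≡⟨ cong (joinᵛ L₁ (L₂ ++ₗ L₃) t₁) (joinᵛ-splitᵛ L₂ L₃ t₂₃) ⟩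
      joinᵛ L₁ (L₂ ++ₗ L₃) t₁ t₂₃
        ≡⟨ joinᵛ-splitᵛ L₁ (L₂ ++ₗ L₃) t ⟩
      t ∎)
      where
      t₁  = proj₁ (splitᵛ L₁ (L₂ ++ₗ L₃) t)
      t₂₃ = proj₂ (splitᵛ L₁ (L₂ ++ₗ L₃) t)
      t₂  = proj₁ (splitᵛ L₂ L₃ t₂₃)
      t₃  = proj₂ (splitᵛ L₂ L₃ t₂₃)
      value< : (M : Mat m) {d : ℕ} → d ≤ m → (u : Vec Bool (length (take d (rowsOf M)))) → bitsToℕ (toList u) < 2 ^ d
      value< M d≤m u = subst (λ k → bitsToℕ (toList u) < 2 ^ k)
                             (trans (length-toList u) (length-take-rows M d≤m)) (bitsToℕ< (toList u))
      Target = Box (bitsToℕ (toList t₁)) (bitsToℕ (toList t₂)) (bitsToℕ (toList t₃))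
      point = count>0⇒∃ Target (2 ^ m)
                (subst (0 <_) (sym (box-count (value< A d₁≤m t₁) (value< B d₂≤m t₂) (value< C d₃≤m t₃))) (s≤s z≤n))
      x = digits m (proj₁ point)
      indices = inBox⁻ (proj₁ point) (proj₂ (proj₂ point))
      t₁≡ = index-injective L₁ x t₁ (proj₁ indices)
      t₂≡ = index-injective L₂ x t₂ (proj₁ (proj₂ indices))
      t₃≡ = index-injective L₃ x t₃ (proj₂ (proj₂ indices))

  firstRows-Nonsingular : Nonsingular (firstRows A B C d₁ d₂ d₃)
  firstRows-Nonsingular = record { kernel-trivial = trivial-kernel ; dots-onto = onto }

isNet0⇒FirstRowsNonsingular : {A B C : Mat m} → IsNet 0 (A ∷ B ∷ C ∷ []) → FirstRowsNonsingular A B C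
isNet0⇒FirstRowsNonsingular net = record
  { nonsingular = λ d₁ d₂ d₃ d-sum → firstRows-Nonsingular net {d₁} {d₂} {d₃} d-sum }

-- Kernels of the first rows of C and C′

take-suc-toList : {X : Set} (M : Vec X m) {j : ℕ} (j<m : j < m) →
                  take (suc j) (toList M) ≡ take j (toList M) ++ₗ [ lookup M (fromℕ< j<m) ]
take-suc-toList (x ∷ M) {zero}  _          = refl
take-suc-toList (x ∷ M) {suc j} (s≤s j<m) = cong (x ∷_) (take-suc-toList M j<m)

Ker-take-suc : (M : Mat m) {j : ℕ} (j<m : j < m) {z : Row m} →
               Ker (take (suc j) (rowsOf M)) z ⇔ (Ker (take j (rowsOf M)) z × dot (lookup M (fromℕ< j<m)) z ≡ false)
Ker-take-suc M {j} j<m {z} = mk⇔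
  (λ k → let kj , kr = All.++⁻ (take j (rowsOf M)) (subst (λ X → Ker X z) (take-suc-toList M j<m) k)
         in kj , All.head kr)
  (λ (kj , rz) → subst (λ X → Ker X z) (sym (take-suc-toList M j<m)) (All.++⁺ kj (rz ∷ [])))

firstRows-sucʳ : {A B C : Mat m} {i k j : ℕ} (j<m : j < m) →
                 firstRows A B C i k (suc j) ≡ firstRows A B C i k j ++ₗ [ lookup C (fromℕ< j<m) ]
firstRows-sucʳ {A = A} {B} {C} {i} {k} {j} j<m = begin
  rA ++ₗ rB ++ₗ take (suc j) (rowsOf C)   ≡⟨ cong (λ X → rA ++ₗ rB ++ₗ X) (take-suc-toList C j<m) ⟩
  rA ++ₗ rB ++ₗ (rC ++ₗ [ c ])            ≡⟨ cong (rA ++ₗ_) (++-assoc rB rC [ c ]) ⟨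
  rA ++ₗ (rB ++ₗ rC) ++ₗ [ c ]            ≡⟨ ++-assoc rA (rB ++ₗ rC) [ c ] ⟨
  (rA ++ₗ rB ++ₗ rC) ++ₗ [ c ]            ∎
  where
  rA = take i (rowsOf A)
  rB = take k (rowsOf B)
  rC = take j (rowsOf C)
  c  = lookup C (fromℕ< j<m)

prefixes-Nonsingular : {A B C : Mat m} → FirstRowsNonsingular A B C →
                       ∀ {j} → j ≤ m → Nonsingular (take (m ∸ j) (rowsOf A) ++ₗ take j (rowsOf C))
prefixes-Nonsingular {m} ns {j} j≤m =
  nonsingular ns (m ∸ j) 0 j (trans (cong (_+ j) (+-identityʳ (m ∸ j))) (m∸n+n≡m j≤m))

firstRows-sucʳ-Nonsingular : {A B C : Mat m} → FirstRowsNonsingular A B C → ∀ i k {j} (j<m : j < m) →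
                             i + k + suc j ≡ m → Nonsingular (firstRows A B C i k j ++ₗ [ lookup C (fromℕ< j<m) ])
firstRows-sucʳ-Nonsingular {A = A} {B} {C} ns i k j<m eq =
  subst Nonsingular (firstRows-sucʳ {A = A} {B} {C} {i} {k} j<m) (nonsingular ns i k _ eq)

∷-firstRows-Nonsingular : {A B C : Mat m} → FirstRowsNonsingular A B C → ∀ {i j} (j<m : j < m) → i + j < m →
                          Nonsingular ([ lookup C (fromℕ< j<m) ] ++ₗ firstRows A B C i (m ∸ i ∸ j ∸ 1) j)
∷-firstRows-Nonsingular {m} {C = C} ns {i} {j} j<m i+j<m =
  Nonsingular-++-comm {L₂ = [ lookup C (fromℕ< j<m) ]} (firstRows-sucʳ-Nonsingular ns i (m ∸ i ∸ j ∸ 1) j<m dimension)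
  where
  dimension : i + (m ∸ i ∸ j ∸ 1) + suc j ≡ m
  dimension = begin
    i + (m ∸ i ∸ j ∸ 1) + suc j        ≡⟨ cong (λ n → i + n + suc j) ∸-collect ⟩
    i + (m ∸ (i + suc j)) + suc j      ≡⟨ rearrange i (m ∸ (i + suc j)) (suc j) ⟩
    m ∸ (i + suc j) + (i + suc j)      ≡⟨ m∸n+n≡m (subst (_≤ m) (sym (+-suc i j)) i+j<m) ⟩
    m                                  ∎
    where
    ∸-collect : m ∸ i ∸ j ∸ 1 ≡ m ∸ (i + suc j)
    ∸-collect = trans (∸-+-assoc (m ∸ i) j 1) (trans (∸-+-assoc m i (j + 1)) (cong (λ x → m ∸ (i + x)) (+-comm j 1)))
    rearrange : ∀ i n s → i + n + s ≡ n + (i + s)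
    rearrange = solve-∀

module _ {m} {A B C C′ : Mat m} (ns : FirstRowsNonsingular A B C) (ns′ : FirstRowsNonsingular A B C′) where

  private
    rA  = rowsOf A
    rC  = rowsOf C
    rC′ = rowsOf C′

  next-rows-agree : ∀ {j} (j<m : j < m) → (∀ z → Ker (take j rC) z → Ker (take j rC′) z) →
                    ∀ z → Ker (take j rC) z → dot (lookup C (fromℕ< j<m)) z ≡ dot (lookup C′ (fromℕ< j<m)) z
  next-rows-agree {j} j<m C⊆C′ z zC = agree (m ∸ j) 0 (m∸n+n≡m (<⇒≤ j<m)) z [] zC
    where
    c  = lookup C  (fromℕ< j<m)
    c′ = lookup C′ (fromℕ< j<m)

    dual-witness : ∀ {i k} → i + k + suc j ≡ m → suc i + k + j ≡ m → (i<m : i < m) →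
                   ∃ λ w → Ker (take i rA) w × Ker (take j rC) w ×
                           dot (lookup A (fromℕ< i<m)) w ≡ true × dot c w ≡ true × dot c′ w ≡ true
    dual-witness {i} {k} eq₁ eq₂ i<m = w , wA , wC , ¬-not aᵢw≢0 , cw , ¬-not c′w≢0
      where
      witness = Ker-∷ʳ-witness (firstRows-sucʳ-Nonsingular ns i k j<m eq₁)
      w     = proj₁ witness
      cw    = proj₂ (proj₂ witness)
      parts = Ker-firstRows⁻ i k (proj₁ (proj₂ witness))
      wA    = proj₁ parts
      wB    = proj₁ (proj₂ parts)
      wC    = proj₂ (proj₂ parts)
      w≢0 : w ≢ zeroV
      w≢0 w≡0 = contradiction (trans (sym cw) (trans (cong (dot c) w≡0) (dot-zeroʳ c))) λ ()
      aᵢw≢0 : dot (lookup A (fromℕ< i<m)) w ≢ false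
      aᵢw≢0 aᵢw = w≢0 (kernel-trivial (nonsingular ns (suc i) k j eq₂) w
                         (Ker-firstRows (from (Ker-take-suc A i<m) (wA , aᵢw)) wB wC))
      c′w≢0 : dot c′ w ≢ false
      c′w≢0 c′w = w≢0 (kernel-trivial (nonsingular ns′ i k (suc j) eq₁) w
                         (Ker-firstRows wA wB (from (Ker-take-suc C′ j<m) (C⊆C′ w wC , c′w))))

    agree : ∀ k i → i + k + j ≡ m → ∀ z → Ker (take i rA) z → Ker (take j rC) z → dot c z ≡ dot c′ z
    agree zero    i eq z zA zC =
      subst (λ z → dot c z ≡ dot c′ z) (sym z≡0) (trans (dot-zeroʳ c) (sym (dot-zeroʳ c′)))
      where
      z≡0 = kernel-trivial (nonsingular ns i 0 j eq) z (Ker-firstRows {A = A} {B} {C} {i} {0} zA [] zC)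
    agree (suc k) i eq z zA zC = by-cases (dot aᵢ z) refl
      where
      eq₂ : suc i + k + j ≡ m
      eq₂ = trans (cong (_+ j) (sym (+-suc i k))) eq
      eq₁ : i + k + suc j ≡ m
      eq₁ = trans (+-suc (i + k) j) eq₂
      i<m : i < m
      i<m = subst (suc i ≤_) eq₂ (≤-trans (m≤m+n (suc i) k) (m≤m+n (suc i + k) j))
      aᵢ = lookup A (fromℕ< i<m)
      by-cases : ∀ b → dot aᵢ z ≡ b → dot c z ≡ dot c′ z
      by-cases false aᵢz = agree k (suc i) eq₂ z (from (Ker-take-suc A i<m) (zA , aᵢz)) zC
      by-cases true  aᵢz =
        let w , wA , wC , aᵢw , cw , c′w = dual-witness eq₁ eq₂ i<m
            zwA = from (Ker-take-suc A i<m) (Ker-⊕ zA wA , trans (dot-distribˡ-⊕ aᵢ z w) (cong₂ _xor_ aᵢz aᵢw))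
        in begin
        dot c z                      ≡⟨ dot-shift c z w ⟩
        dot c (z ⊕ w) xor dot c w    ≡⟨ cong₂ _xor_ (agree k (suc i) eq₂ (z ⊕ w) zwA (Ker-⊕ zC wC)) (trans cw (sym c′w)) ⟩
        dot c′ (z ⊕ w) xor dot c′ w  ≡⟨ dot-shift c′ z w ⟨
        dot c′ z                     ∎

  Ker-take-C⇔C′ : ∀ j → j ≤ m → ∀ z → Ker (take j rC) z ⇔ Ker (take j rC′) z
  Ker-take-C⇔C′ zero    _   z = mk⇔ (λ _ → []) (λ _ → [])
  Ker-take-C⇔C′ (suc j) j<m z = mk⇔ forward backward
    where
    same : ∀ z → Ker (take j rC) z ⇔ Ker (take j rC′) z
    same = Ker-take-C⇔C′ j (<⇒≤ j<m)
    agree = next-rows-agree j<m (λ z → to (same z))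
    forward : Ker (take (suc j) rC) z → Ker (take (suc j) rC′) z
    forward k = let kC , cz = to (Ker-take-suc C j<m) k
                in from (Ker-take-suc C′ j<m) (to (same z) kC , trans (sym (agree z kC)) cz)
    backward : Ker (take (suc j) rC′) z → Ker (take (suc j) rC) z
    backward k = let kC′ , c′z = to (Ker-take-suc C′ j<m) k
                     kC = from (same z) kC′
                 in from (Ker-take-suc C j<m) (kC , trans (agree z kC) c′z)

  C′-row-difference : (j : Fin m) → Σ (Row m) λ w → InSpan (take (toℕ j) rC) w × lookup C′ j ≡ lookup C j ⊕ w
  C′-row-difference j =
    lookup C j ⊕ lookup C′ j , ⊥Ker⇒InSpan (prefixes-Nonsingular ns (<⇒≤ j<m)) difference⊥ , sym (⊕-cancelˡ _ _)
    where
    j<m = toℕ<n j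
    difference⊥ : ∀ z → Ker (take (toℕ j) rC) z → dot (lookup C j ⊕ lookup C′ j) z ≡ false
    difference⊥ z k = begin
      dot (lookup C j ⊕ lookup C′ j) z             ≡⟨ dot-distribʳ-⊕ (lookup C j) (lookup C′ j) z ⟩
      dot (lookup C j) z xor dot (lookup C′ j) z   ≡⟨ cong (_xor dot (lookup C′ j) z) agree ⟩
      dot (lookup C′ j) z xor dot (lookup C′ j) z  ≡⟨ xor-same (dot (lookup C′ j) z) ⟩
      false                                        ∎
      where
      agree : dot (lookup C j) z ≡ dot (lookup C′ j) z
      agree = subst (λ i → dot (lookup C i) z ≡ dot (lookup C′ i) z) (fromℕ<-toℕ j j<m)
                (next-rows-agree j<m (λ z → to (Ker-take-C⇔C′ (toℕ j) (<⇒≤ j<m) z)) z k)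

  span-take-C≡C′ : ∀ j → j ≤ m → SameSpan (take j rC) (take j rC′)
  span-take-C≡C′ j j≤m =
    sameKer⇒SameSpan (prefixes-Nonsingular ns j≤m) (prefixes-Nonsingular ns′ j≤m) (Ker-take-C⇔C′ j j≤m)

  span-firstRows-C≡C′ : ∀ i j → i + j < m →
                        SameSpan (firstRows A B C i (m ∸ i ∸ j ∸ 1) j) (firstRows A B C′ i (m ∸ i ∸ j ∸ 1) j)
  span-firstRows-C≡C′ i j i+j<m =
    sameKer⇒SameSpan {Q = [ lookup C (fromℕ< j<m) ]} {Q′ = [ lookup C′ (fromℕ< j<m) ]}
      (∷-firstRows-Nonsingular ns j<m i+j<m) (∷-firstRows-Nonsingular ns′ j<m i+j<m) sameKer
    where
    j<m = ≤-<-trans (m≤n+m j i) i+j<m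
    k = m ∸ i ∸ j ∸ 1
    sameKer : ∀ z → Ker (firstRows A B C i k j) z ⇔ Ker (firstRows A B C′ i k j) z
    sameKer z = mk⇔
      (λ ker → let kA , kB , kC  = Ker-firstRows⁻ i k ker in Ker-firstRows kA kB (to   (C⇔C′ z) kC))
      (λ ker → let kA , kB , kC′ = Ker-firstRows⁻ i k ker in Ker-firstRows kA kB (from (C⇔C′ z) kC′))
      where
      C⇔C′ = Ker-take-C⇔C′ j (<⇒≤ j<m)

lemma11 : (m : ℕ) (A B C C′ : Mat m) →
    TValue (A ∷ B ∷ C ∷ []) 0 → TValue (A ∷ B ∷ C′ ∷ []) 0 →
    -- (i) c′_j ∈ c_j + ⟨c_1,…,c_{j-1}⟩ for 1 ≤ j ≤ m  (j 0-based here)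
    ((j : Fin m) → Σ (Row m) λ w → InSpan (take (toℕ j) (rowsOf C)) w × lookup C′ j ≡ lookup C j ⊕ w)
    -- (ii) ⟨c_1,…,c_j⟩ = ⟨c′_1,…,c′_j⟩ for 1 ≤ j ≤ m
    × ((j : ℕ) → 1 ≤ j → j ≤ m → SameSpan (take j (rowsOf C)) (take j (rowsOf C′)))
    -- (iii) V_{i,j} = W_{i,j} for i + j ≤ m - 1
    × ((i j : ℕ) → i + j < m →
        SameSpan (take i (rowsOf A) ++ₗ take (m ∸ i ∸ j ∸ 1) (rowsOf B) ++ₗ take j (rowsOf C))
                 (take i (rowsOf A) ++ₗ take (m ∸ i ∸ j ∸ 1) (rowsOf B) ++ₗ take j (rowsOf C′)))
lemma11 m A B C C′ t₀ t₀′ =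
    C′-row-difference ns ns′
  , (λ j _ → span-take-C≡C′ ns ns′ j)
  , span-firstRows-C≡C′ ns ns′
  where
  ns  = isNet0⇒FirstRowsNonsingular (proj₁ t₀)
  ns′ = isNet0⇒FirstRowsNonsingular (proj₁ t₀′)
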